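{- Let $G$ be a $4$-colorable graph, let $M\subseteq V(G)$ be nonempty with $G[M]$ connected, and let $V'_1,\dots,V'_4$ be the augmented sets obtained from a good $4$-coloring of $G[M]$ as described in the context. For $x\in M$, $$u(x)\ge\begin{cases}\left(\frac45 d_G(x)+1\right)c(x)+\frac15 s(x)-4 & \text{if } d_G(x)\le 3,\\ 4c(x)-4 & \text{if } d_G(x)\ge 4.\end{cases}$$
   Context: Potential: for a $4$-colorable graph $G$, $\phi_G(e)=\frac35$ for each edge $e$ and $\phi_G(v)=1+\frac15\min\{d_G(v),3\}$ for each vertex $v$, where $d_G$ is degree in $G$; $\Phi(G)=\sum_{x\in V(G)\cup E(G)}\phi_G(x)$. For independent $X\subseteq M$: $u_X(v)=\phi_G(v)+\frac35 d_G(v)-1$ if $v\in X$; $u_X(v)=\phi_G(v)-\phi_{G-X}(v)-1$ if $v\in M-X$; $u_X(v)=\phi_G(v)-\phi_{G-X}(v)$ if $v\notin M$; and $u(X)=\Phi(G)-\Phi(G-X)-|M|$. Good coloring: let $T$ be the vertices of $M$ lying on no cycle of $G[M]$, $S=M-T$; components of $G[T]$ are tree-components. A good $4$-coloring of $G[M]$ is a proper coloring with color classes $V_1,\dots,V_4$ such that for each tree-component, its vertices together with their neighbors in $G[M]$ use at most two colors. Augmentation: let $P=\{v\in M: d_{G[M]}(v)\le 2\}$. For each component of $G[P]$ with vertex set $Q$ (so $G[Q]$ is a path or cycle), choose a largest independent set $R$ of $G[Q]$, and for each $v\in R$ add $v$ to every color class that contains neither $v$ nor any neighbor of $v$. Doing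 this for all components of $G[P]$ yields independent sets $V'_1\supseteq V_1,\dots,V'_4\supseteq V_4$ covering $M$. For $x\in V(G)$, $c(x)$ is the number of indices $i$ with $x\in V'_i$, $s(x)=\sum_{y\in N_{G[M]}(x)}c(y)$, and $u(x)=\sum_{i=1}^4 u_{V'_i}(x)$. -}

module Defs where

open import Data.Nat as ℕ using (ℕ; zero; suc; _⊓_; _≤ᵇ_)
open import Data.Integer using (+_)
open import Data.Rational using (ℚ; _/_; 1ℚ; 0ℚ; _+_; _-_; _*_)
open import Data.Bool using (Bool; true; false; _∧_; _∨_; not; if_then_else_)
open import Data.Fin using (Fin; _≟_)
open import Data.List using (List; []; _∷_; _++_; [_]; length)
open import Data.List.Relation.Unary.All using (All)
open import Data.List.Relation.Unary.Linked using (Linked)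
open import Data.List.Relation.Unary.Unique.Propositional using (Unique)
open import Data.List.Membership.Propositional using (_∈_)
open import Data.Product using (Σ; ∃; ∃₂; _×_; _,_)
open import Data.Sum using (_⊎_)
open import Relation.Nullary using (¬_; does)
open import Relation.Binary.PropositionalEquality using (_≡_; _≢_)

record Graph (n : ℕ) : Set where
  field
    adj    : Fin n → Fin n → Bool
    sym    : ∀ u v → adj u v ≡ adj v u
    irrefl : ∀ v → adj v v ≡ false
open Graph public

Adj : ∀ {n} → Graph n → Fin n → Fin n → Set
Adj G u v = adj G u v ≡ true

sumF : ∀ {n} → (Fin n → ℕ) → ℕ
sumF {zero}  f = 0
sumF {suc n} f = f Data.Fin.zero ℕ.+ sumF (λ i → f (Data.Fin.suc i))

sumFℚ : ∀ {n} → (Fin n → ℚ) → ℚ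
sumFℚ {zero}  f = 0ℚ
sumFℚ {suc n} f = f Data.Fin.zero + sumFℚ (λ i → f (Data.Fin.suc i))

count : ∀ {n} → (Fin n → Bool) → ℕ
count f = sumF (λ i → if f i then 1 else 0)

anyF : ∀ {n} → (Fin n → Bool) → Bool
anyF {zero}  f = false
anyF {suc n} f = f Data.Fin.zero ∨ anyF (λ i → f (Data.Fin.suc i))

ℕ→ℚ : ℕ → ℚ
ℕ→ℚ k = + k / 1

deg : ∀ {n} → Graph n → Fin n → ℕ
deg G v = count (λ w → adj G v w)

-- degree of v in G - X (for v ∉ X): neighbours of v outside X
degMinus : ∀ {n} → Graph n → (Fin n → Bool) → Fin n → ℕ
degMinus G X v = count (λ w → adj G v w ∧ not (X w))

-- degree of v in G[M] (for v ∈ M)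
degIn : ∀ {n} → Graph n → (Fin n → Bool) → Fin n → ℕ
degIn G M v = count (λ w → adj G v w ∧ M w)

phiV : ℕ → ℚ
phiV d = 1ℚ + (+ (d ⊓ 3)) / 5

-- u_X(v) for v ∈ M  (the case v ∉ M is not needed for the lemma)
--   v ∈ X     :  φ_G(v) + (3/5) d_G(v) - 1
--   v ∈ M - X :  φ_G(v) - φ_{G-X}(v) - 1
uX : ∀ {n} → Graph n → (Fin n → Bool) → (X : Fin n → Bool) → Fin n → ℚ
uX G M X v =
  if M v
  then (if X v
        then phiV (deg G v) + (+ 3 / 5) * ℕ→ℚ (deg G v) - 1ℚ
        else phiV (deg G v) - phiV (degMinus G X v) - 1ℚ)
  else phiV (deg G v) - phiV (degMinus G X v)

Proper4 : ∀ {n} → Graph n → (Fin n → Fin 4) → Set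
Proper4 G f = ∀ u v → Adj G u v → f u ≢ f v

FourColorable : ∀ {n} → Graph n → Set
FourColorable G = ∃ λ f → Proper4 G f

ProperOn : ∀ {n} → Graph n → (Fin n → Bool) → (Fin n → Fin 4) → Set
ProperOn G M col =
  ∀ u v → M u ≡ true → M v ≡ true → Adj G u v → col u ≢ col v

data Reach {n} (G : Graph n) (S : Fin n → Set) : Fin n → Fin n → Set where
  here : ∀ {a} → S a → Reach G S a a
  step : ∀ {a b c} → S a → Adj G a b → Reach G S b c → Reach G S a c

InB : ∀ {n} → (Fin n → Bool) → Fin n → Set
InB M v = M v ≡ true

ConnectedOn : ∀ {n} → Graph n → (Fin n → Bool) → Set
ConnectedOn G M = ∀ a b → M a ≡ true → M b ≡ true → Reach G (InB M) a b

OnCycle : ∀ {n} → Graph n → (Fin n → Bool) → Fin n → Set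
OnCycle G M v =
  Σ (List _) λ ws →
    (2 ℕ.≤ length ws)
    × Unique (v ∷ ws)
    × All (InB M) (v ∷ ws)
    × Linked (Adj G) (v ∷ ws ++ [ v ])

InT : ∀ {n} → Graph n → (Fin n → Bool) → Fin n → Set
InT G M v = (M v ≡ true) × ¬ OnCycle G M v

-- Good 4-colouring of G[M]: proper, and for each tree-component C
-- (component of G[T], given as the component of t ∈ T), the vertices of C
-- together with their neighbours in G[M] use at most two colours.
GoodColoring : ∀ {n} → Graph n → (Fin n → Bool) → (Fin n → Fin 4) → Set
GoodColoring G M col =
  ProperOn G M col ×
  (∀ t → InT G M t →
     ∃₂ λ c₁ c₂ → ∀ w →
       (Reach G (InT G M) t w
         ⊎ ((M w ≡ true) × ∃ λ z → Reach G (InT G M) t z × Adj G z w)) →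
       (col w ≡ c₁) ⊎ (col w ≡ c₂))

classV : ∀ {n} → (Fin n → Bool) → (Fin n → Fin 4) → Fin 4 → Fin n → Bool
classV M col i v = M v ∧ does (col v ≟ i)

setP : ∀ {n} → Graph n → (Fin n → Bool) → Fin n → Bool
setP G M v = M v ∧ (degIn G M v ≤ᵇ 2)

Independent : ∀ {n} → Graph n → (Fin n → Bool) → Set
Independent G I = ∀ u v → I u ≡ true → I v ≡ true → Adj G u v → ⊥'
  where open import Data.Empty renaming (⊥ to ⊥')

-- R is the union, over the components Q of G[P], of a largest independent
-- set of G[Q].  Components of G[P] are given as the component of p ∈ P.
AugChoice : ∀ {n} → Graph n → (Fin n → Bool) → (Fin n → Bool) → Set
AugChoice {n} G M R =
  (∀ v → R v ≡ true → setP G M v ≡ true)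
  × Independent G R
  × (∀ p → setP G M p ≡ true →
       ∀ (I J : Fin n → Bool) → Independent G I →
       (∀ v → I v ≡ true → Reach G (InB (setP G M)) p v) →
       (∀ v → J v ≡ true → (R v ≡ true × Reach G (InB (setP G M)) p v)) →
       (∀ v → (R v ≡ true × Reach G (InB (setP G M)) p v) → J v ≡ true) →
       count I ℕ.≤ count J)

augV : ∀ {n} → Graph n → (Fin n → Bool) → (Fin n → Fin 4) → (Fin n → Bool)
       → Fin 4 → Fin n → Bool
augV G M col R i v =
  classV M col i v
  ∨ (R v ∧ not (classV M col i v)
         ∧ not (anyF (λ w → adj G v w ∧ classV M col i w)))

cnt : ∀ {n} → Graph n → (Fin n → Bool) → (Fin n → Fin 4) → (Fin n → Bool)
      → Fin n → ℕ
cnt G M col R x = count (λ i → augV G M col R i x)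

sN : ∀ {n} → Graph n → (Fin n → Bool) → (Fin n → Fin 4) → (Fin n → Bool)
     → Fin n → ℕ
sN G M col R x =
  sumF (λ y → if adj G x y ∧ M y then cnt G M col R y else 0)

uTot : ∀ {n} → Graph n → (Fin n → Bool) → (Fin n → Fin 4) → (Fin n → Bool)
       → Fin n → ℚ
uTot G M col R x = sumFℚ (λ i → uX G M (augV G M col R i) x)

module Submission where

-- The bound is checked one augmented colour class at a time.  Write
-- bᵢ = [x ∈ V'ᵢ], kᵢ = number of neighbours of x in V'ᵢ and d = d_G(x),
-- so that c(x) = Σᵢ bᵢ, s(x) = Σᵢ kᵢ (every V'ᵢ lies inside M) and
-- d_{G-V'ᵢ}(x) = d - kᵢ.  Each V'ᵢ is independent, hence bᵢ = 1 forces
-- kᵢ = 0.  Since φ is affine on degrees ≤ 3 and constant (= 8/5) on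
-- degrees ≥ 3, one class contributes
--   * exactly (4d/5 + 1)·bᵢ + kᵢ/5 - 1   when d ≤ 3, and
--   * at least 4·bᵢ - 1                  when d ≥ 4.
-- Summing these over the four classes gives the two inequalities.

open import Defs
open import Data.Nat using (ℕ)
open import Data.Integer using (+_)
open import Data.Rational using (ℚ; _/_; _+_; _-_; _*_; _≤_)
open import Data.Bool using (Bool)
open import Data.Fin using (Fin)
open import Data.Product using (∃; _×_)
open import Relation.Binary.PropositionalEquality using (_≡_)

open import Data.Nat as ℕ using (zero; suc; s≤s; z≤n)
import Data.Nat.Properties as ℕP
import Data.Integer as ℤ
import Data.Integer.Properties as ℤP
open import Data.Rational using (mkℚ; 0ℚ; 1ℚ; -_; _≤?_)
import Data.Nat.Coprimality as C
import Data.Rational.Properties as ℚP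
open import Data.Rational.Solver using (module +-*-Solver)
open import Data.Bool using (true; false; _∧_; not; if_then_else_)
open import Data.Fin using (_≟_) renaming (zero to fzero; suc to fsuc)
open import Data.Product using (_,_; proj₁)
open import Data.Sum using (_⊎_; inj₁; inj₂)
open import Data.Empty using (⊥-elim)
open import Relation.Nullary using (¬_; yes; no)
open import Relation.Nullary.Decidable using (toWitness)
open import Relation.Binary.PropositionalEquality
  using (refl; trans; cong; cong₂; module ≡-Reasoning)
  renaming (sym to ≡-sym)
import Algebra.Properties.CommutativeSemigroup as CommSemigroupProperties
open import Algebra.Bundles using (CommutativeMonoid)
open +-*-Solver using (solve; _:=_; _:+_; _:*_; _:-_; con)

ℕ→ℚ-mkℚ : ∀ a → ℕ→ℚ a ≡ mkℚ (+ a) 0 (C.sym (C.1-coprimeTo a))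
ℕ→ℚ-mkℚ a = ℚP.normalize-coprime (C.sym (C.1-coprimeTo a))

ℕ→ℚ-+ : ∀ a b → ℕ→ℚ (a ℕ.+ b) ≡ ℕ→ℚ a + ℕ→ℚ b
ℕ→ℚ-+ a b rewrite ℕ→ℚ-mkℚ a | ℕ→ℚ-mkℚ b =
  ℚP./-cong (trans (ℤP.pos-+ a b)
                   (cong₂ ℤ._+_ (≡-sym (ℤP.*-identityʳ (+ a))) (≡-sym (ℤP.*-identityʳ (+ b)))))
            refl

ℕ→ℚ-mono : ∀ {a b} → a ℕ.≤ b → ℕ→ℚ a ≤ ℕ→ℚ b
ℕ→ℚ-mono {a} {b} a≤b rewrite ℕ→ℚ-mkℚ a | ℕ→ℚ-mkℚ b =
  Data.Rational.*≤* (ℤP.*-monoʳ-≤-nonNeg (+ 1) (ℤ.+≤+ a≤b))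

ℕ-interchange : ∀ a b c d → (a ℕ.+ b) ℕ.+ (c ℕ.+ d) ≡ (a ℕ.+ c) ℕ.+ (b ℕ.+ d)
ℕ-interchange = CommSemigroupProperties.interchange ℕP.+-commutativeSemigroup

ℚ-interchange : ∀ a b c d → (a + b) + (c + d) ≡ (a + c) + (b + d)
ℚ-interchange = CommSemigroupProperties.interchange
                  (CommutativeMonoid.commutativeSemigroup ℚP.+-0-commutativeMonoid)

indicator : Bool → ℕ
indicator b = if b then 1 else 0

sumF-cong : ∀ {n} {f g : Fin n → ℕ} → (∀ i → f i ≡ g i) → sumF f ≡ sumF g
sumF-cong {zero}  f≡g = refl
sumF-cong {suc n} f≡g = cong₂ ℕ._+_ (f≡g fzero) (sumF-cong (λ i → f≡g (fsuc i)))

sumF-zero : ∀ {n} → sumF {n} (λ _ → 0) ≡ 0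
sumF-zero {zero}  = refl
sumF-zero {suc n} = sumF-zero {n}

sumF-+ : ∀ {n} (f g : Fin n → ℕ) → sumF (λ i → f i ℕ.+ g i) ≡ sumF f ℕ.+ sumF g
sumF-+ {zero}  f g = refl
sumF-+ {suc n} f g rewrite sumF-+ (λ i → f (fsuc i)) (λ i → g (fsuc i)) =
  ℕ-interchange (f fzero) (g fzero) (sumF (λ i → f (fsuc i))) (sumF (λ i → g (fsuc i)))

sumF-swap : ∀ {m n} (f : Fin m → Fin n → ℕ) →
            sumF (λ y → sumF (f y)) ≡ sumF (λ i → sumF (λ y → f y i))
sumF-swap {zero} {n} f = ≡-sym (sumF-zero {n})
sumF-swap {suc m} f rewrite sumF-swap (λ y → f (fsuc y)) =
  ≡-sym (sumF-+ (f fzero) (λ i → sumF (λ y → f (fsuc y) i)))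

ℕ→ℚ-sumF : ∀ {n} (f : Fin n → ℕ) → ℕ→ℚ (sumF f) ≡ sumFℚ (λ i → ℕ→ℚ (f i))
ℕ→ℚ-sumF {zero}  f = refl
ℕ→ℚ-sumF {suc n} f = trans (ℕ→ℚ-+ (f fzero) (sumF (λ i → f (fsuc i))))
                           (cong (_+_ (ℕ→ℚ (f fzero))) (ℕ→ℚ-sumF (λ i → f (fsuc i))))

sumFℚ-cong : ∀ {n} {f g : Fin n → ℚ} → (∀ i → f i ≡ g i) → sumFℚ f ≡ sumFℚ g
sumFℚ-cong {zero}  f≡g = refl
sumFℚ-cong {suc n} f≡g = cong₂ _+_ (f≡g fzero) (sumFℚ-cong (λ i → f≡g (fsuc i)))

sumFℚ-mono : ∀ {n} {f g : Fin n → ℚ} → (∀ i → f i ≤ g i) → sumFℚ f ≤ sumFℚ g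
sumFℚ-mono {zero}  f≤g = ℚP.≤-refl
sumFℚ-mono {suc n} f≤g = ℚP.+-mono-≤ (f≤g fzero) (sumFℚ-mono (λ i → f≤g (fsuc i)))

sumFℚ-+ : ∀ {n} (f g : Fin n → ℚ) → sumFℚ (λ i → f i + g i) ≡ sumFℚ f + sumFℚ g
sumFℚ-+ {zero}  f g = refl
sumFℚ-+ {suc n} f g = begin
  (f₀ + g₀) + sumFℚ (λ i → f (fsuc i) + g (fsuc i))
    ≡⟨ cong (_+_ (f₀ + g₀)) (sumFℚ-+ (λ i → f (fsuc i)) (λ i → g (fsuc i))) ⟩
  (f₀ + g₀) + (F + G)
    ≡⟨ ℚ-interchange f₀ g₀ F G ⟩
  (f₀ + F) + (g₀ + G)
    ∎
  where
  open ≡-Reasoning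
  f₀ g₀ F G : ℚ
  f₀ = f fzero
  g₀ = g fzero
  F = sumFℚ (λ i → f (fsuc i))
  G = sumFℚ (λ i → g (fsuc i))

sumFℚ-*ˡ : ∀ {n} (A : ℚ) (f : Fin n → ℚ) → sumFℚ (λ i → A * f i) ≡ A * sumFℚ f
sumFℚ-*ˡ {zero}  A f = ≡-sym (ℚP.*-zeroʳ A)
sumFℚ-*ˡ {suc n} A f = trans (cong (_+_ (A * f fzero)) (sumFℚ-*ˡ A (λ i → f (fsuc i))))
                             (≡-sym (ℚP.*-distribˡ-+ A (f fzero) (sumFℚ (λ i → f (fsuc i)))))

sumFℚ-minus-const : ∀ {n} (f : Fin n → ℚ) (C : ℚ) →
                    sumFℚ (λ i → f i - C) ≡ sumFℚ f - ℕ→ℚ n * C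
sumFℚ-minus-const {zero}  f = solve 1 (λ c → con 0ℚ := con 0ℚ :- con 0ℚ :* c) refl
sumFℚ-minus-const {suc n} f C = begin
  (f₀ - C) + sumFℚ (λ i → f (fsuc i) - C)
    ≡⟨ cong (_+_ (f₀ - C)) (sumFℚ-minus-const (λ i → f (fsuc i)) C) ⟩
  (f₀ - C) + (F - ℕ→ℚ n * C)
    ≡⟨ regroup f₀ F (ℕ→ℚ n) C ⟩
  (f₀ + F) - (1ℚ + ℕ→ℚ n) * C
    ≡⟨ cong (λ k → (f₀ + F) - k * C) (≡-sym (ℕ→ℚ-+ 1 n)) ⟩
  (f₀ + F) - ℕ→ℚ (suc n) * C
    ∎
  where
  open ≡-Reasoning
  f₀ F : ℚ
  f₀ = f fzero
  F = sumFℚ (λ i → f (fsuc i))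
  regroup : ∀ a b k c → (a - c) + (b - k * c) ≡ (a + b) - (1ℚ + k) * c
  regroup = solve 4 (λ a b k c → (a :- c) :+ (b :- k :* c) := (a :+ b) :- (con 1ℚ :+ k) :* c) refl

sumFℚ-scaled : ∀ {n} (A : ℚ) (f : Fin n → ℕ) →
               sumFℚ (λ i → A * ℕ→ℚ (f i)) ≡ A * ℕ→ℚ (sumF f)
sumFℚ-scaled A f = trans (sumFℚ-*ˡ A (λ i → ℕ→ℚ (f i))) (cong (A *_) (≡-sym (ℕ→ℚ-sumF f)))

sumFℚ-affine₁ : ∀ {n} (A C : ℚ) (f : Fin n → ℕ) →
                sumFℚ (λ i → A * ℕ→ℚ (f i) - C) ≡ A * ℕ→ℚ (sumF f) - ℕ→ℚ n * C
sumFℚ-affine₁ A C f = trans (sumFℚ-minus-const (λ i → A * ℕ→ℚ (f i)) C)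
                            (cong (_- _) (sumFℚ-scaled A f))

sumFℚ-affine₂ : ∀ {n} (A B C : ℚ) (f g : Fin n → ℕ) →
                sumFℚ (λ i → A * ℕ→ℚ (f i) + B * ℕ→ℚ (g i) - C)
                ≡ A * ℕ→ℚ (sumF f) + B * ℕ→ℚ (sumF g) - ℕ→ℚ n * C
sumFℚ-affine₂ A B C f g =
  trans (sumFℚ-minus-const (λ i → A * ℕ→ℚ (f i) + B * ℕ→ℚ (g i)) C)
        (cong (_- _) (trans (sumFℚ-+ (λ i → A * ℕ→ℚ (f i)) (λ i → B * ℕ→ℚ (g i)))
                            (cong₂ _+_ (sumFℚ-scaled A f) (sumFℚ-scaled B g))))

count-split : ∀ {n} (a X : Fin n → Bool) →
              count a ≡ count (λ w → a w ∧ not (X w)) ℕ.+ count (λ w → a w ∧ X w)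
count-split a X = trans (sumF-cong split-point)
                        (sumF-+ (λ w → indicator (a w ∧ not (X w)))
                                (λ w → indicator (a w ∧ X w)))
  where
  split-point : ∀ w → indicator (a w) ≡ indicator (a w ∧ not (X w)) ℕ.+ indicator (a w ∧ X w)
  split-point w with a w | X w
  ... | true  | true  = refl
  ... | true  | false = refl
  ... | false | _     = refl

count-empty : ∀ {n} (f : Fin n → Bool) → (∀ w → f w ≡ false) → count f ≡ 0
count-empty {n} f empty = trans (sumF-cong (λ w → cong indicator (empty w))) (sumF-zero {n})

anyF-false : ∀ {n} (f : Fin n → Bool) → anyF f ≡ false → ∀ v → f v ≡ false
anyF-false {suc n} f none v with f fzero in f₀
anyF-false {suc n} f ()   v        | true
anyF-false {suc n} f none fzero    | false = f₀
anyF-false {suc n} f none (fsuc v) | false = anyF-false (λ i → f (fsuc i)) none v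

phiV-affine : ∀ {d} → d ℕ.≤ 3 → phiV d ≡ 1ℚ + (+ 1 / 5) * ℕ→ℚ d
phiV-affine {0} _ = refl
phiV-affine {1} _ = refl
phiV-affine {2} _ = refl
phiV-affine {3} _ = refl
phiV-affine {suc (suc (suc (suc _)))} (s≤s (s≤s (s≤s ())))

phiV-loss : ∀ d k → d ℕ.+ k ℕ.≤ 3 → phiV (d ℕ.+ k) - phiV d ≡ (+ 1 / 5) * ℕ→ℚ k
phiV-loss d k d+k≤3 = begin
  phiV (d ℕ.+ k) - phiV d
    ≡⟨ cong₂ _-_ (phiV-affine d+k≤3) (phiV-affine (ℕP.≤-trans (ℕP.m≤m+n d k) d+k≤3)) ⟩
  (1ℚ + (+ 1 / 5) * ℕ→ℚ (d ℕ.+ k)) - (1ℚ + (+ 1 / 5) * ℕ→ℚ d)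
    ≡⟨ cong (λ q → (1ℚ + (+ 1 / 5) * q) - (1ℚ + (+ 1 / 5) * ℕ→ℚ d)) (ℕ→ℚ-+ d k) ⟩
  (1ℚ + (+ 1 / 5) * (ℕ→ℚ d + ℕ→ℚ k)) - (1ℚ + (+ 1 / 5) * ℕ→ℚ d)
    ≡⟨ solve 2 (λ D K → (con 1ℚ :+ con (+ 1 / 5) :* (D :+ K)) :- (con 1ℚ :+ con (+ 1 / 5) :* D)
                        := con (+ 1 / 5) :* K) refl (ℕ→ℚ d) (ℕ→ℚ k) ⟩
  (+ 1 / 5) * ℕ→ℚ k
    ∎
  where open ≡-Reasoning

phiV-saturated : ∀ {d} → 4 ℕ.≤ d → phiV d ≡ + 8 / 5
phiV-saturated (s≤s (s≤s (s≤s (s≤s _)))) = refl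

phiV-≤-max : ∀ d → phiV d ≤ + 8 / 5
phiV-≤-max 0 = toWitness {a? = phiV 0 ≤? + 8 / 5} _
phiV-≤-max 1 = toWitness {a? = phiV 1 ≤? + 8 / 5} _
phiV-≤-max 2 = toWitness {a? = phiV 2 ≤? + 8 / 5} _
phiV-≤-max 3 = toWitness {a? = phiV 3 ≤? + 8 / 5} _
phiV-≤-max (suc (suc (suc (suc d)))) =
  ℚP.≤-reflexive (phiV-saturated {4 ℕ.+ d} (s≤s (s≤s (s≤s (s≤s z≤n)))))

-- u_X(x) for x ∈ M in terms of b = [x ∈ X], d = d_G(x) and d' = d_{G-X}(x).
contribution : Bool → ℕ → ℕ → ℚ
contribution true  d d' = phiV d + (+ 3 / 5) * ℕ→ℚ d - 1ℚ
contribution false d d' = phiV d - phiV d' - 1ℚ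

small-coefficient : ℕ → ℚ
small-coefficient d = (+ 4 / 5) * ℕ→ℚ d + + 1 / 1

contribution-small : ∀ b {d d' k} → d ℕ.≤ 3 → d ≡ d' ℕ.+ k → (b ≡ true → k ≡ 0) →
                     contribution b d d'
                     ≡ small-coefficient d * ℕ→ℚ (indicator b) + (+ 1 / 5) * ℕ→ℚ k - 1ℚ
contribution-small true {d} d≤3 _ member⇒k≡0 rewrite member⇒k≡0 refl = begin
  phiV d + (+ 3 / 5) * ℕ→ℚ d - 1ℚ
    ≡⟨ cong (λ p → p + (+ 3 / 5) * ℕ→ℚ d - 1ℚ) (phiV-affine d≤3) ⟩
  1ℚ + (+ 1 / 5) * ℕ→ℚ d + (+ 3 / 5) * ℕ→ℚ d - 1ℚ
    ≡⟨ solve 1 (λ D → con 1ℚ :+ con (+ 1 / 5) :* D :+ con (+ 3 / 5) :* D :- con 1ℚ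
                      := (con (+ 4 / 5) :* D :+ con 1ℚ) :* con 1ℚ :+ con (+ 1 / 5) :* con 0ℚ :- con 1ℚ)
               refl (ℕ→ℚ d) ⟩
  small-coefficient d * 1ℚ + (+ 1 / 5) * 0ℚ - 1ℚ
    ∎
  where open ≡-Reasoning
contribution-small false {d' = d'} {k} d≤3 refl _ = begin
  phiV (d' ℕ.+ k) - phiV d' - 1ℚ
    ≡⟨ cong (_- 1ℚ) (phiV-loss d' k d≤3) ⟩
  (+ 1 / 5) * ℕ→ℚ k - 1ℚ
    ≡⟨ solve 2 (λ A K → con (+ 1 / 5) :* K :- con 1ℚ := A :* con 0ℚ :+ con (+ 1 / 5) :* K :- con 1ℚ)
               refl (small-coefficient (d' ℕ.+ k)) (ℕ→ℚ k) ⟩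
  small-coefficient (d' ℕ.+ k) * 0ℚ + (+ 1 / 5) * ℕ→ℚ k - 1ℚ
    ∎
  where open ≡-Reasoning

-- For d ≥ 4 the contribution is at least 4·b - 1: a member gains
-- 8/5 + 3d/5 - 1 ≥ 3, a non-member loses at most 1 since φ(d) is maximal.
contribution-large : ∀ b {d d'} → 4 ℕ.≤ d →
                     (+ 4 / 1) * ℕ→ℚ (indicator b) - 1ℚ ≤ contribution b d d'
contribution-large true {d} 4≤d = begin
  + 3 / 1                                   ≡⟨ refl ⟩
  + 8 / 5 + (+ 3 / 5) * ℕ→ℚ 4 - 1ℚ          ≤⟨ ℚP.+-monoˡ-≤ (- 1ℚ) (ℚP.+-monoʳ-≤ (+ 8 / 5)
                                                 (ℚP.*-monoˡ-≤-nonNeg (+ 3 / 5) (ℕ→ℚ-mono 4≤d))) ⟩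
  + 8 / 5 + (+ 3 / 5) * ℕ→ℚ d - 1ℚ          ≡⟨ cong (λ p → p + (+ 3 / 5) * ℕ→ℚ d - 1ℚ)
                                                 (≡-sym (phiV-saturated 4≤d)) ⟩
  phiV d + (+ 3 / 5) * ℕ→ℚ d - 1ℚ           ∎
  where open ℚP.≤-Reasoning
contribution-large false {d} {d'} 4≤d = begin
  - 1ℚ                        ≡⟨ cong (_- 1ℚ) (≡-sym (ℚP.+-inverseʳ (phiV d'))) ⟩
  phiV d' - phiV d' - 1ℚ      ≤⟨ ℚP.+-monoˡ-≤ (- 1ℚ) (ℚP.+-monoˡ-≤ (- phiV d') φd'≤φd) ⟩
  phiV d - phiV d' - 1ℚ       ∎
  where
  open ℚP.≤-Reasoning
  φd'≤φd : phiV d' ≤ phiV d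
  φd'≤φd = ℚP.≤-trans (phiV-≤-max d') (ℚP.≤-reflexive (≡-sym (phiV-saturated 4≤d)))

nbrsIn : ∀ {n} → Graph n → (Fin n → Bool) → Fin n → ℕ
nbrsIn G X x = count (λ w → adj G x w ∧ X w)

deg-split : ∀ {n} (G : Graph n) (X : Fin n → Bool) x →
            deg G x ≡ degMinus G X x ℕ.+ nbrsIn G X x
deg-split G X x = count-split (adj G x) X

nbrsIn-independent : ∀ {n} (G : Graph n) {X : Fin n → Bool} → Independent G X →
                     ∀ {x} → X x ≡ true → nbrsIn G X x ≡ 0
nbrsIn-independent G {X} indep {x} x∈X = count-empty _ no-neighbour
  where
  no-neighbour : ∀ w → (adj G x w ∧ X w) ≡ false
  no-neighbour w with adj G x w in x~w | X w in w∈X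
  ... | true  | true  = ⊥-elim (indep x w x∈X w∈X x~w)
  ... | true  | false = refl
  ... | false | _     = refl

uX-contribution : ∀ {n} (G : Graph n) (M X : Fin n → Bool) {x} → M x ≡ true →
                  uX G M X x ≡ contribution (X x) (deg G x) (degMinus G X x)
uX-contribution G M X {x} x∈M rewrite x∈M with X x
... | true  = refl
... | false = refl

module AugmentedClasses {n} (G : Graph n) (M : Fin n → Bool) (col : Fin n → Fin 4)
                        (R : Fin n → Bool) where

  V′ : Fin 4 → Fin n → Bool
  V′ = augV G M col R

  class-member : ∀ i v → classV M col i v ≡ true → (M v ≡ true) × (col v ≡ i)
  class-member i v v∈Vᵢ with M v | col v ≟ i
  class-member i v v∈Vᵢ | true  | yes colᵥ≡i = refl , colᵥ≡i
  class-member i v ()   | true  | no  _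
  class-member i v ()   | false | _

  augmented-member : ∀ i v → V′ i v ≡ true →
    (classV M col i v ≡ true) ⊎
    ((R v ≡ true) × (anyF (λ w → adj G v w ∧ classV M col i w) ≡ false))
  augmented-member i v v∈V′ᵢ
    with classV M col i v | R v | anyF (λ w → adj G v w ∧ classV M col i w)
  ... | true  | _     | _     = inj₁ refl
  ... | false | true  | false = inj₂ (refl , refl)
  augmented-member i v () | false | true  | true
  augmented-member i v () | false | false | _

  augmented-⊆-M : (∀ v → R v ≡ true → M v ≡ true) → ∀ i v → V′ i v ≡ true → M v ≡ true
  augmented-⊆-M R⊆M i v v∈V′ᵢ with augmented-member i v v∈V′ᵢ
  ... | inj₁ v∈Vᵢ      = proj₁ (class-member i v v∈Vᵢ)
  ... | inj₂ (v∈R , _) = R⊆M v v∈R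

  added-not-adjacent : ∀ i u v → classV M col i u ≡ true →
                       anyF (λ w → adj G v w ∧ classV M col i w) ≡ false → ¬ Adj G u v
  added-not-adjacent i u v u∈Vᵢ none u~v
    with anyF-false _ none u
  ... | no-edge rewrite Graph.sym G v u | u~v | u∈Vᵢ with no-edge
  ... | ()

  -- Each V'ᵢ is independent: Vᵢ is (the colouring is proper on M), R is,
  -- and an added vertex has no neighbour in Vᵢ.
  augmented-independent : ProperOn G M col → Independent G R → ∀ i → Independent G (V′ i)
  augmented-independent proper R-indep i u v u∈ v∈ u~v
    with augmented-member i u u∈ | augmented-member i v v∈
  ... | inj₁ u∈Vᵢ | inj₁ v∈Vᵢ =
    let (u∈M , colᵤ≡i) = class-member i u u∈Vᵢ
        (v∈M , colᵥ≡i) = class-member i v v∈Vᵢ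
    in proper u v u∈M v∈M u~v (trans colᵤ≡i (≡-sym colᵥ≡i))
  ... | inj₁ u∈Vᵢ       | inj₂ (_ , none) = added-not-adjacent i u v u∈Vᵢ none u~v
  ... | inj₂ (_ , none) | inj₁ v∈Vᵢ       =
    added-not-adjacent i v u v∈Vᵢ none (trans (Graph.sym G v u) u~v)
  ... | inj₂ (u∈R , _)  | inj₂ (v∈R , _)  = R-indep u v u∈R v∈R u~v

  -- s(x) = Σᵢ |N(x) ∩ V'ᵢ|: count the pairs (y, i) with y ~ x and y ∈ V'ᵢ
  -- in the other order; vertices outside M lie in no V'ᵢ.
  s-by-classes : (∀ v → R v ≡ true → M v ≡ true) →
                 ∀ x → sN G M col R x ≡ sumF (λ i → nbrsIn G (V′ i) x)
  s-by-classes R⊆M x = trans (sumF-cong pairs-at) (sumF-swap pair)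
    where
    pair : Fin n → Fin 4 → ℕ
    pair y i = indicator (adj G x y ∧ V′ i y)

    outside-M : ∀ y → M y ≡ false → ∀ i → V′ i y ≡ false
    outside-M y y∉M i with V′ i y in y∈V′ᵢ
    ... | false = refl
    ... | true with () ← trans (≡-sym y∉M) (augmented-⊆-M R⊆M i y y∈V′ᵢ)

    vanishes-off : ∀ b {c} → (b ≡ false → c ≡ 0) → (if b then c else 0) ≡ c
    vanishes-off true  _   = refl
    vanishes-off false c≡0 = ≡-sym (c≡0 refl)

    pairs-at : ∀ y → (if adj G x y ∧ M y then cnt G M col R y else 0) ≡ sumF (pair y)
    pairs-at y with adj G x y
    ... | false = ≡-sym (sumF-zero {4})
    ... | true  = vanishes-off (M y) (λ y∉M → count-empty (λ i → V′ i y) (outside-M y y∉M))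

setP-⊆-M : ∀ {n} (G : Graph n) (M : Fin n → Bool) v → setP G M v ≡ true → M v ≡ true
setP-⊆-M G M v v∈P with M v
... | true = refl

lemma21 : ∀ {n} (G : Graph n) → FourColorable G →
            (M : Fin n → Bool) → (∃ λ v → M v ≡ Bool.true) → ConnectedOn G M →
            (col : Fin n → Fin 4) → GoodColoring G M col →
            (R : Fin n → Bool) → AugChoice G M R →
            ∀ x → M x ≡ Bool.true →
            ((deg G x Data.Nat.≤ 3 →
               ((+ 4 / 5) * ℕ→ℚ (deg G x) + + 1 / 1) * ℕ→ℚ (cnt G M col R x)
                 + (+ 1 / 5) * ℕ→ℚ (sN G M col R x) - + 4 / 1
               ≤ uTot G M col R x)
            × (4 Data.Nat.≤ deg G x →
               (+ 4 / 1) * ℕ→ℚ (cnt G M col R x) - + 4 / 1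
               ≤ uTot G M col R x))
lemma21 G _ M _ _ col (proper , _) R (R⊆P , R-indep , _) x x∈M = small-degree , large-degree
  where
  open AugmentedClasses G M col R
  R⊆M : ∀ v → R v ≡ true → M v ≡ true
  R⊆M v v∈R = setP-⊆-M G M v (R⊆P v v∈R)
  d : ℕ
  d = deg G x
  b : Fin 4 → Bool
  b i = V′ i x
  k : Fin 4 → ℕ
  k i = nbrsIn G (V′ i) x
  u≡contribution : ∀ i → uX G M (V′ i) x ≡ contribution (b i) d (degMinus G (V′ i) x)
  u≡contribution i = uX-contribution G M (V′ i) x∈M

  small-degree : d ℕ.≤ 3 →
                 small-coefficient d * ℕ→ℚ (cnt G M col R x) + (+ 1 / 5) * ℕ→ℚ (sN G M col R x) - + 4 / 1
                 ≤ uTot G M col R x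
  small-degree d≤3 = ℚP.≤-reflexive (begin
    small-coefficient d * ℕ→ℚ (cnt G M col R x) + (+ 1 / 5) * ℕ→ℚ (sN G M col R x) - + 4 / 1
      ≡⟨ cong (λ s → small-coefficient d * ℕ→ℚ (cnt G M col R x) + (+ 1 / 5) * ℕ→ℚ s - + 4 / 1)
              (s-by-classes R⊆M x) ⟩
    small-coefficient d * ℕ→ℚ (sumF (λ i → indicator (b i))) + (+ 1 / 5) * ℕ→ℚ (sumF k) - ℕ→ℚ 4 * 1ℚ
      ≡⟨ ≡-sym (sumFℚ-affine₂ (small-coefficient d) (+ 1 / 5) 1ℚ (λ i → indicator (b i)) k) ⟩
    sumFℚ (λ i → small-coefficient d * ℕ→ℚ (indicator (b i)) + (+ 1 / 5) * ℕ→ℚ (k i) - 1ℚ)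
      ≡⟨ sumFℚ-cong (λ i → ≡-sym (trans (u≡contribution i)
           (contribution-small (b i) d≤3 (deg-split G (V′ i) x)
              (nbrsIn-independent G (augmented-independent proper R-indep i))))) ⟩
    uTot G M col R x
      ∎)
    where open ≡-Reasoning

  large-degree : 4 ℕ.≤ d → (+ 4 / 1) * ℕ→ℚ (cnt G M col R x) - + 4 / 1 ≤ uTot G M col R x
  large-degree 4≤d = begin
    (+ 4 / 1) * ℕ→ℚ (cnt G M col R x) - ℕ→ℚ 4 * 1ℚ
      ≡⟨ ≡-sym (sumFℚ-affine₁ (+ 4 / 1) 1ℚ (λ i → indicator (b i))) ⟩
    sumFℚ (λ i → (+ 4 / 1) * ℕ→ℚ (indicator (b i)) - 1ℚ)
      ≤⟨ sumFℚ-mono (λ i → ℚP.≤-trans (contribution-large (b i) 4≤d)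
                                      (ℚP.≤-reflexive (≡-sym (u≡contribution i)))) ⟩
    uTot G M col R x
      ∎
    where open ℚP.≤-Reasoning
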